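{- Let $H$ be a ribbon hypermap and $A\subseteq E(H)$, $A^c=E(H)\setminus A$. Then $$\chi(H^{A})=\chi(A)+\chi(A^{c})-2v(H).$$
   Context: A ribbon hypermap $H$ is a (possibly non-orientable) surface with boundary, written as the union of two sets of discs, the hypervertices $V(H)$ and the hyperedges $E(H)$, such that hypervertices and hyperedges meet in disjoint line segments (common line segments), each lying on the boundary of exactly one hypervertex and exactly one hyperedge. Hyperfaces are the boundary components of the surface. $v(H),e(H),f(H)$ are the numbers of hypervertices, hyperedges, hyperfaces; $d(e)$ is the number of common line segments on hyperedge $e$ and $d(H)=\sum_e d(e)$. The Euler characteristic (for $H$ connected or not) is $\chi(H)=v(H)+e(H)+f(H)-d(H)$. For $A\subseteq E(H)$, $A$ also denotes the sub-ribbon hypermap obtained from $H$ by deleting all hyperedges not in $A$ but keeping all hypervertices (even isolated ones). Partial dual $H^A$: in an arrow presentation of $H$ (hypervertices as closed curves; each hyperedge $e$ as arrows $e_1,\dots,e_{d(e)}$ along its common line segments in cyclic order around $e$), for each $e\in A$ and each $i$ draw a new arrow from the head of $e_i$ to the tail of $e_{i+1}$ (indices mod $d(e)$), label it $e_i$, and delete the original arrows; the new arrows become arcs of the closed curves of the arrow presentation of $H^A$ (equivalently, the hypervertices of $H^A$ are the boundary components of the sub-ribbon hypermap $A$, and the hyperedges are unchanged). -}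

module Defs where

open import Data.Nat using (ℕ; zero; suc; _<ᵇ_)
open import Data.Fin using (Fin; toℕ; _≟_)
open import Data.Bool using (Bool; true; false; _∧_; _∨_; not; if_then_else_)
open import Data.List using (List; []; _∷_; allFin; filterᵇ; length)
open import Data.Bool.ListAction using (any; all)
open import Data.Integer as ℤ using (ℤ; +_)
open import Relation.Nullary using (¬_; does)
open import Relation.Binary.PropositionalEquality using (_≡_; _≢_; refl; sym; trans)

BPred : ℕ → Set
BPred n = Fin n → Bool

iter : {A : Set} → ℕ → (A → A) → A → A
iter zero    f a = a
iter (suc k) f a = f (iter k f a)

-- one closure step: add every point one generator away from S
-- (the generators are involutions, so preimage = image)
closeStep : ∀ {n} → List (Fin n → Fin n) → BPred n → BPred n
closeStep gs S y = S y ∨ any (λ g → S (g y)) gs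

-- the orbit of x under the group generated by gs (n steps suffice)
orbitOf : ∀ {n} → List (Fin n → Fin n) → Fin n → BPred n
orbitOf {n} gs x = iter n (closeStep gs) (λ y → does (y ≟ x))

isLeastInOrbit : ∀ {n} → List (Fin n → Fin n) → Fin n → Bool
isLeastInOrbit {n} gs x =
  all (λ y → not ((toℕ y <ᵇ toℕ x) ∧ orbitOf gs x y)) (allFin n)

-- number of orbits of ⟨gs⟩ contained in the (⟨gs⟩-invariant) set P
numOrbitsIn : ∀ {n} → List (Fin n → Fin n) → BPred n → ℕ
numOrbitsIn {n} gs P =
  length (filterᵇ (λ x → P x ∧ isLeastInOrbit gs x) (allFin n))

numOrbits : ∀ {n} → List (Fin n → Fin n) → ℕ
numOrbits gs = numOrbitsIn gs (λ _ → true)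

-- Ribbon hypermaps (possibly non-orientable), three-involution model.
--
-- X = Fin n is the set of endpoints of the common line segments.
--   τ  swaps the two endpoints of each common line segment;
--   σV swaps the two endpoints of each boundary arc of a hypervertex
--      lying between consecutive common line segments;
--   σE the same for the boundary arcs of hyperedges.
-- Hypervertex boundaries = orbits of ⟨τ,σV⟩, hyperedge boundaries =
-- orbits of ⟨τ,σE⟩, hyperfaces (boundary components of the surface) =
-- orbits of ⟨σV,σE⟩, common line segments = orbits of ⟨τ⟩.
-- Hypervertices meeting no hyperedge are not visible in X and are
-- counted by 'isolated' (each is one hypervertex and one hyperface).

record RibbonHypermap : Set where
  field
    n        : ℕ
    τ σV σE  : Fin n → Fin n
    τ-inv    : ∀ x → τ (τ x) ≡ x
    τ-fpf    : ∀ x → τ x ≢ x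
    σV-inv   : ∀ x → σV (σV x) ≡ x
    σV-fpf   : ∀ x → σV x ≢ x
    σE-inv   : ∀ x → σE (σE x) ≡ x
    σE-fpf   : ∀ x → σE x ≢ x
    isolated : ℕ

module _ (H : RibbonHypermap) where
  open RibbonHypermap H

  vH : ℕ
  vH = numOrbits (τ ∷ σV ∷ []) Data.Nat.+ isolated

  eH : ℕ
  eH = numOrbits (τ ∷ σE ∷ [])

  fH : ℕ
  fH = numOrbits (σV ∷ σE ∷ []) Data.Nat.+ isolated

  dH : ℕ
  dH = numOrbits (τ ∷ [])

  χ : ℤ
  χ = + vH ℤ.+ + eH ℤ.+ + fH ℤ.- + dH

  -- A set of hyperedges, given as a Boolean marking of X that is
  -- constant on each hyperedge (i.e. a union of ⟨τ,σE⟩-orbits).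
  record EdgeSet : Set where
    field
      mem     : BPred n
      mem-τ   : ∀ x → mem (τ x) ≡ mem x
      mem-σE  : ∀ x → mem (σE x) ≡ mem x

  complement : EdgeSet → EdgeSet
  complement A = record
    { mem = λ x → not (mem x)
    ; mem-τ = λ x → cong-not (mem-τ x)
    ; mem-σE = λ x → cong-not (mem-σE x) }
    where
      open EdgeSet A
      cong-not : ∀ {a b} → a ≡ b → not a ≡ not b
      cong-not refl = refl

  -- Boundary-walk involution of the sub-ribbon hypermap A: along a
  -- hyperedge of A follow its free boundary arc (σE); at a common line
  -- segment of a deleted hyperedge, the segment is now part of the
  -- hypervertex boundary, so cross it (τ).
  ρ : EdgeSet → Fin n → Fin n
  ρ A x = if EdgeSet.mem A x then σE x else τ x

  -- Euler characteristic of the sub-ribbon hypermap A (all hypervertices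
  -- kept, hyperedges not in A deleted).
  χSub : EdgeSet → ℤ
  χSub A = + vA ℤ.+ + eA ℤ.+ + fA ℤ.- + dA
    where
      vA = vH
      eA = numOrbitsIn (τ ∷ σE ∷ []) (EdgeSet.mem A)
      fA = numOrbits (σV ∷ ρ A ∷ []) Data.Nat.+ isolated
      dA = numOrbitsIn (τ ∷ []) (EdgeSet.mem A)

  -- For e ∈ A the new arrows run along the free
  -- boundary arcs of e (head of e_i to tail of e_{i+1}), so the roles of
  -- τ and σE are exchanged on the endpoints belonging to hyperedges of A.
  -- Hypervertices of H^A = orbits of ⟨σV, ρ A⟩ = boundary components of
  -- the sub-ribbon hypermap A; hyperedges are unchanged.
  partialDual : EdgeSet → RibbonHypermap
  partialDual A = record
    { n = n
    ; τ = τ'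
    ; σV = σV
    ; σE = σE'
    ; τ-inv = τ'-inv
    ; τ-fpf = τ'-fpf
    ; σV-inv = σV-inv
    ; σV-fpf = σV-fpf
    ; σE-inv = σE'-inv
    ; σE-fpf = σE'-fpf
    ; isolated = isolated }
    where
      open EdgeSet A
      τ' σE' : Fin n → Fin n
      τ' x = if mem x then σE x else τ x
      σE' x = if mem x then τ x else σE x

      τ'-inv : ∀ x → τ' (τ' x) ≡ x
      τ'-inv x with mem x in eq
      ... | true  rewrite trans (mem-σE x) eq = σE-inv x
      ... | false rewrite trans (mem-τ x) eq = τ-inv x

      τ'-fpf : ∀ x → τ' x ≢ x
      τ'-fpf x with mem x
      ... | true  = σE-fpf x
      ... | false = τ-fpf x

      σE'-inv : ∀ x → σE' (σE' x) ≡ x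
      σE'-inv x with mem x in eq
      ... | true  rewrite trans (mem-τ x) eq = τ-inv x
      ... | false rewrite trans (mem-σE x) eq = σE-inv x

      σE'-fpf : ∀ x → σE' x ≢ x
      σE'-fpf x with mem x
      ... | true  = τ-fpf x
      ... | false = σE-fpf x

module Submission where

-- In the three-involution model, H^A exchanges τ and σE on the points of A.
-- So the hypervertices of H^A are the ⟨σV, ρ A⟩-orbits, i.e. the hyperfaces
-- of the sub-hypermap A; its hyperfaces are, symmetrically, those of Aᶜ; its
-- hyperedges are those of H, each lying in A or in Aᶜ; and its common line
-- segments are the τ-orbits on Aᶜ together with the σE-orbits on A.  The
-- latter are as many as the τ-orbits on A, since a fixed-point-free
-- involution of an invariant set has half as many orbits as the set has
-- points.  Substituting these counts, the two copies of v(H) in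
-- χ(A) + χ(Aᶜ) are exactly what the correction term removes.

open import Defs

open import Data.Fin using (Fin; zero; suc; toℕ; _≟_)
open import Data.Fin.Properties using (toℕ-injective)
open import Data.Fin.Permutation using (permutation)
open import Data.Bool using (Bool; true; false; _∧_; _∨_; not)
open import Data.Bool.Properties using (∨-identityʳ; ∨-zeroʳ; ∨-comm; ∨-idem; ∧-comm; ∧-zeroʳ; ∧-identityʳ)
open import Data.Bool.ListAction using (any; all)
open import Data.List using (List; []; _∷_; allFin; filterᵇ; length; tabulate)
open import Data.List.Membership.Propositional using (_∈_)
open import Data.List.Membership.Propositional.Properties using (∈-allFin)
open import Data.List.Relation.Unary.Any using (here; there)
open import Data.Product using (_×_; _,_; proj₂)
open import Data.Sum using (_⊎_; inj₁; inj₂)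
open import Function using (_∘_; id)
open import Relation.Nullary using (does; yes; no; contradiction)
open import Relation.Nullary.Decidable using (dec-true; dec-false)
open import Relation.Binary.PropositionalEquality

module OrbitCounting where

  open import Data.Nat using (ℕ; zero; suc; _+_; _*_; _<ᵇ_)
  open import Data.Nat.Properties using (+-0-commutativeMonoid; +-suc; +-identityʳ)
  open import Algebra.Properties.CommutativeMonoid.Sum +-0-commutativeMonoid using (sum; sum-permute)

  count : ∀ {n} → BPred n → ℕ
  count {n} P = length (filterᵇ P (allFin n))

  indicator : Bool → ℕ
  indicator true  = 1
  indicator false = 0

  length-filterᵇ-tabulate : ∀ {n} {A : Set} (p : A → Bool) (f : Fin n → A) →
    length (filterᵇ p (tabulate f)) ≡ sum (indicator ∘ p ∘ f)
  length-filterᵇ-tabulate {zero}  p f = refl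
  length-filterᵇ-tabulate {suc n} p f with p (f zero)
  ... | true  = cong suc (length-filterᵇ-tabulate p (f ∘ suc))
  ... | false = length-filterᵇ-tabulate p (f ∘ suc)

  length-filterᵇ-cong : ∀ {A : Set} {p q : A → Bool} → (∀ x → p x ≡ q x) → ∀ xs →
    length (filterᵇ p xs) ≡ length (filterᵇ q xs)
  length-filterᵇ-cong p≗q [] = refl
  length-filterᵇ-cong {p = p} {q} p≗q (x ∷ xs) with p x | q x | p≗q x
  ... | true  | true  | refl = cong suc (length-filterᵇ-cong p≗q xs)
  ... | false | false | refl = length-filterᵇ-cong p≗q xs

  length-filterᵇ-split : ∀ {A : Set} (p q : A → Bool) xs →
    length (filterᵇ (λ x → p x ∧ q x) xs) + length (filterᵇ (λ x → not (p x) ∧ q x) xs)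
    ≡ length (filterᵇ q xs)
  length-filterᵇ-split p q [] = refl
  length-filterᵇ-split p q (x ∷ xs) with p x | q x
  ... | true  | true  = cong suc (length-filterᵇ-split p q xs)
  ... | true  | false = length-filterᵇ-split p q xs
  ... | false | true  = trans (+-suc _ _) (cong suc (length-filterᵇ-split p q xs))
  ... | false | false = length-filterᵇ-split p q xs

  count-∘-involution : ∀ {n} (P : BPred n) {g : Fin n → Fin n} →
    (∀ x → g (g x) ≡ x) → count (P ∘ g) ≡ count P
  count-∘-involution P {g} g-inv = begin
    count (P ∘ g)            ≡⟨ length-filterᵇ-tabulate (P ∘ g) id ⟩
    sum (indicator ∘ P ∘ g)  ≡⟨ sum-permute (indicator ∘ P) (permutation g g g-inv g-inv) ⟨
    sum (indicator ∘ P)      ≡⟨ length-filterᵇ-tabulate P id ⟨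
    count P                  ∎
    where open ≡-Reasoning

  all-true : ∀ {A : Set} {p : A → Bool} → (∀ y → p y ≡ true) → ∀ xs → all p xs ≡ true
  all-true p≡true []       = refl
  all-true p≡true (x ∷ xs) rewrite p≡true x = all-true p≡true xs

  all-false : ∀ {A : Set} {p : A → Bool} {z xs} → p z ≡ false → z ∈ xs → all p xs ≡ false
  all-false pz≡false (here refl) rewrite pz≡false = refl
  all-false {p = p} {xs = x ∷ _} pz≡false (there z∈xs) =
    trans (cong (p x ∧_) (all-false pz≡false z∈xs)) (∧-zeroʳ (p x))

  any-cong : ∀ {A : Set} {p q : A → Bool} → (∀ y → p y ≡ q y) → ∀ xs → any p xs ≡ any q xs
  any-cong p≗q []       = refl
  any-cong p≗q (x ∷ xs) = cong₂ _∨_ (p≗q x) (any-cong p≗q xs)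

  all-cong : ∀ {A : Set} {p q : A → Bool} → (∀ y → p y ≡ q y) → ∀ xs → all p xs ≡ all q xs
  all-cong p≗q []       = refl
  all-cong p≗q (x ∷ xs) = cong₂ _∧_ (p≗q x) (all-cong p≗q xs)

  <ᵇ-irrefl : ∀ m → (m <ᵇ m) ≡ false
  <ᵇ-irrefl zero    = refl
  <ᵇ-irrefl (suc m) = <ᵇ-irrefl m

  <ᵇ-swap : ∀ m n → m ≢ n → (m <ᵇ n) ≡ not (n <ᵇ m)
  <ᵇ-swap zero    zero    m≢n = contradiction refl m≢n
  <ᵇ-swap zero    (suc n) m≢n = refl
  <ᵇ-swap (suc m) zero    m≢n = refl
  <ᵇ-swap (suc m) (suc n) m≢n = <ᵇ-swap m n (m≢n ∘ cong suc)

  ∨-swapʳ : ∀ a b → a ∨ (b ∨ false) ≡ b ∨ (a ∨ false)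
  ∨-swapʳ a b rewrite ∨-identityʳ a | ∨-identityʳ b = ∨-comm a b

  iter-≗ : ∀ {A B : Set} {f f' : (A → B) → (A → B)} →
    (∀ {S S'} → (∀ y → S y ≡ S' y) → ∀ y → f S y ≡ f S' y) →
    (∀ S y → f S y ≡ f' S y) →
    ∀ k S y → iter k f S y ≡ iter k f' S y
  iter-≗ f-resp f≗f' zero    S y = refl
  iter-≗ f-resp f≗f' (suc k) S y =
    trans (f-resp (iter-≗ f-resp f≗f' k S) y) (f≗f' (iter k _ S) y)

  closeStep-resp : ∀ {n} (gs : List (Fin n → Fin n)) {S S' : BPred n} →
    (∀ y → S y ≡ S' y) → ∀ y → closeStep gs S y ≡ closeStep gs S' y
  closeStep-resp gs S≗S' y = cong₂ _∨_ (S≗S' y) (any-cong (λ g → S≗S' (g y)) gs)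

  numOrbitsIn-orbitOf-cong : ∀ {n} (gs gs' : List (Fin n → Fin n)) (P : BPred n) →
    (∀ x → P x ≡ true → ∀ y → orbitOf gs x y ≡ orbitOf gs' x y) →
    numOrbitsIn gs P ≡ numOrbitsIn gs' P
  numOrbitsIn-orbitOf-cong {n} gs gs' P orbits≗ = length-filterᵇ-cong representative≗ (allFin n)
    where
      representative≗ : ∀ x → (P x ∧ isLeastInOrbit gs x) ≡ (P x ∧ isLeastInOrbit gs' x)
      representative≗ x with P x in Px
      ... | false = refl
      ... | true  = all-cong (λ y → cong (λ b → not ((toℕ y <ᵇ toℕ x) ∧ b)) (orbits≗ x Px y)) (allFin n)

  numOrbitsIn-closeStep-cong : ∀ {n} (gs gs' : List (Fin n → Fin n)) (P : BPred n) →
    (∀ S y → closeStep gs S y ≡ closeStep gs' S y) →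
    numOrbitsIn gs P ≡ numOrbitsIn gs' P
  numOrbitsIn-closeStep-cong {n} gs gs' P steps≗ =
    numOrbitsIn-orbitOf-cong gs gs' P (λ x _ → iter-≗ (closeStep-resp gs) steps≗ n _)

  SameUnorderedPair : ∀ {n} (g h g' h' : Fin n → Fin n) → Set
  SameUnorderedPair g h g' h' = ∀ y → (g' y ≡ g y × h' y ≡ h y) ⊎ (g' y ≡ h y × h' y ≡ g y)

  numOrbitsIn-unorderedPair : ∀ {n} {g h g' h' : Fin n → Fin n} (P : BPred n) →
    SameUnorderedPair g h g' h' → numOrbitsIn (g ∷ h ∷ []) P ≡ numOrbitsIn (g' ∷ h' ∷ []) P
  numOrbitsIn-unorderedPair {g = g} {h} {g'} {h'} P samePair =
    numOrbitsIn-closeStep-cong (g ∷ h ∷ []) (g' ∷ h' ∷ []) P steps≗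
    where
      steps≗ : ∀ S y → closeStep (g ∷ h ∷ []) S y ≡ closeStep (g' ∷ h' ∷ []) S y
      steps≗ S y with samePair y
      ... | inj₁ (g'y , h'y) rewrite g'y | h'y = refl
      ... | inj₂ (g'y , h'y) rewrite g'y | h'y = cong (S y ∨_) (∨-swapʳ (S (g y)) (S (h y)))

  numOrbitsIn-split : ∀ {n} (gs : List (Fin n → Fin n)) (P : BPred n) →
    numOrbitsIn gs P + numOrbitsIn gs (not ∘ P) ≡ numOrbits gs
  numOrbitsIn-split {n} gs P = length-filterᵇ-split P (isLeastInOrbit gs) (allFin n)

  involutionOrbit : ∀ {n} → (Fin n → Fin n) → Fin n → BPred n
  involutionOrbit g x y = does (y ≟ x) ∨ does (g y ≟ x)

  iter-closeStep-involution : ∀ {n} {g : Fin n → Fin n} → (∀ x → g (g x) ≡ x) →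
    ∀ k x y → iter (suc k) (closeStep (g ∷ [])) (λ y → does (y ≟ x)) y ≡ involutionOrbit g x y
  iter-closeStep-involution g-inv zero    x y = cong (does (y ≟ x) ∨_) (∨-identityʳ _)
  iter-closeStep-involution {g = g} g-inv (suc k) x y =
    trans (cong₂ (λ a b → a ∨ (b ∨ false)) (iter-closeStep-involution g-inv k x y)
                                           (iter-closeStep-involution g-inv k x (g y)))
          closed
    where
      closed : involutionOrbit g x y ∨ (involutionOrbit g x (g y) ∨ false) ≡ involutionOrbit g x y
      closed rewrite g-inv y | ∨-identityʳ (does (g y ≟ x) ∨ does (y ≟ x))
                   | ∨-comm (does (g y ≟ x)) (does (y ≟ x)) = ∨-idem _

  orbitOf-involution : ∀ {n} {g : Fin n → Fin n} → (∀ x → g (g x) ≡ x) →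
    ∀ x y → orbitOf (g ∷ []) x y ≡ involutionOrbit g x y
  orbitOf-involution {suc n} g-inv = iter-closeStep-involution g-inv n

  module _ {n} {g : Fin n → Fin n} (g-inv : ∀ x → g (g x) ≡ x) where

    descends : Fin n → Bool
    descends x = toℕ (g x) <ᵇ toℕ x

    -- The orbit of x is {x, g x}, so x represents it iff g x is not smaller.
    isLeastInOrbit-involution : ∀ x → isLeastInOrbit (g ∷ []) x ≡ not (descends x)
    isLeastInOrbit-involution x = trans (all-cong orbit≗ (allFin n)) least
      where
        notSmaller : Fin n → Bool
        notSmaller y = not ((toℕ y <ᵇ toℕ x) ∧ involutionOrbit g x y)

        orbit≗ : ∀ y → not ((toℕ y <ᵇ toℕ x) ∧ orbitOf (g ∷ []) x y) ≡ notSmaller y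
        orbit≗ y = cong (λ b → not ((toℕ y <ᵇ toℕ x) ∧ b)) (orbitOf-involution g-inv x y)

        notSmaller-g : notSmaller (g x) ≡ not (descends x)
        notSmaller-g rewrite dec-true (g (g x) ≟ x) (g-inv x) | ∨-zeroʳ (does (g x ≟ x))
                           | ∧-identityʳ (descends x) = refl

        notSmaller-other : ∀ y → y ≢ g x → notSmaller y ≡ true
        notSmaller-other y y≢gx with y ≟ x
        ... | yes refl rewrite <ᵇ-irrefl (toℕ y) = refl
        ... | no _ rewrite dec-false (g y ≟ x) (λ gy≡x → y≢gx (trans (sym (g-inv y)) (cong g gy≡x)))
                         | ∧-zeroʳ (toℕ y <ᵇ toℕ x) = refl

        least : all notSmaller (allFin n) ≡ not (descends x)
        least with descends x in d
        ... | true  = all-false (trans notSmaller-g (cong not d)) (∈-allFin (g x))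
        ... | false = all-true notSmaller-everywhere (allFin n)
          where
            notSmaller-everywhere : ∀ y → notSmaller y ≡ true
            notSmaller-everywhere y with y ≟ g x
            ... | yes refl = trans notSmaller-g (cong not d)
            ... | no y≢gx = notSmaller-other y y≢gx

    module _ (g-fpf : ∀ x → g x ≢ x) (P : BPred n) (P-g : ∀ x → P (g x) ≡ P x) where

      descends-g : ∀ x → descends (g x) ≡ not (descends x)
      descends-g x rewrite g-inv x = <ᵇ-swap (toℕ x) (toℕ (g x)) (g-fpf x ∘ sym ∘ toℕ-injective)

      -- g exchanges the descending and the non-descending points of P.
      numOrbitsIn-fpfInvolution : 2 * numOrbitsIn (g ∷ []) P ≡ count P
      numOrbitsIn-fpfInvolution = begin
        2 * numOrbitsIn (g ∷ []) P                ≡⟨ cong (2 *_) representatives ⟩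
        2 * count ascending                        ≡⟨ cong (count ascending +_) (+-identityʳ _) ⟩
        count ascending + count ascending          ≡⟨ cong (_+ count ascending) (length-filterᵇ-cong swap (allFin n)) ⟨
        count (descending ∘ g) + count ascending   ≡⟨ cong (_+ count ascending) (count-∘-involution descending g-inv) ⟩
        count descending + count ascending         ≡⟨ length-filterᵇ-split descends P (allFin n) ⟩
        count P                                    ∎
        where
          open ≡-Reasoning
          ascending descending : BPred n
          ascending  x = not (descends x) ∧ P x
          descending x = descends x ∧ P x

          representatives : numOrbitsIn (g ∷ []) P ≡ count ascending
          representatives = length-filterᵇ-cong
            (λ x → trans (cong (P x ∧_) (isLeastInOrbit-involution x)) (∧-comm (P x) _)) (allFin n)

          swap : ∀ x → descending (g x) ≡ ascending x
          swap x = cong₂ _∧_ (descends-g x) (P-g x)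

  -- Orbits starting in Q never leave Q, where h and g agree.
  module _ {n} (Q : BPred n) {g h : Fin n → Fin n}
           (h≗g : ∀ y → Q y ≡ true → h y ≡ g y)
           (Q-g : ∀ y → Q (g y) ≡ Q y) (Q-h : ∀ y → Q (h y) ≡ Q y) where

    private
      SupportedIn : BPred n → Set
      SupportedIn S = ∀ y → Q y ≡ false → S y ≡ false

      closeStep-supported : ∀ S → SupportedIn S → SupportedIn (closeStep (g ∷ []) S)
      closeStep-supported S S⊆Q y Qy rewrite S⊆Q y Qy | S⊆Q (g y) (trans (Q-g y) Qy) = refl

      closeStep-agree : ∀ S → SupportedIn S → ∀ y → closeStep (h ∷ []) S y ≡ closeStep (g ∷ []) S y
      closeStep-agree S S⊆Q y with Q y in Qy
      ... | true  rewrite h≗g y Qy = refl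
      ... | false rewrite S⊆Q (h y) (trans (Q-h y) Qy) | S⊆Q (g y) (trans (Q-g y) Qy) = refl

      iter-agree : ∀ S → SupportedIn S → ∀ k →
        SupportedIn (iter k (closeStep (g ∷ [])) S) ×
        (∀ y → iter k (closeStep (h ∷ [])) S y ≡ iter k (closeStep (g ∷ [])) S y)
      iter-agree S S⊆Q zero    = S⊆Q , λ _ → refl
      iter-agree S S⊆Q (suc k) =
        let (supported , agree) = iter-agree S S⊆Q k
        in  closeStep-supported _ supported ,
            λ y → trans (closeStep-resp (h ∷ []) agree y) (closeStep-agree _ supported y)

    numOrbitsIn-agree : numOrbitsIn (h ∷ []) Q ≡ numOrbitsIn (g ∷ []) Q
    numOrbitsIn-agree = numOrbitsIn-orbitOf-cong (h ∷ []) (g ∷ []) Q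
      (λ x Qx → proj₂ (iter-agree _ (singleton-supported x Qx) n))
      where
        singleton-supported : ∀ x → Q x ≡ true → SupportedIn (λ y → does (y ≟ x))
        singleton-supported x Qx y Qy = dec-false (y ≟ x) λ { refl → true≢false (trans (sym Qx) Qy) }
          where true≢false : true ≢ false
                true≢false ()

module PartialDualCounts (H : RibbonHypermap) where

  open import Data.Nat using (ℕ; _+_)
  open import Data.Nat.Properties using (*-cancelˡ-≡)
  open OrbitCounting
  open RibbonHypermap H

  subEdges subFaces subSegments : EdgeSet H → ℕ
  subEdges    A = numOrbitsIn (τ ∷ σE ∷ []) (EdgeSet.mem A)
  subFaces    A = numOrbits (σV ∷ ρ H A ∷ []) + isolated
  subSegments A = numOrbitsIn (τ ∷ []) (EdgeSet.mem A)

  module _ (A : EdgeSet H) where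

    open EdgeSet A
    private
      Aᶜ = complement H A
      H^A = partialDual H A
      module H^A = RibbonHypermap H^A

    partialDual-vH : vH H^A ≡ subFaces A
    partialDual-vH = cong (_+ isolated) (numOrbitsIn-unorderedPair _ swapped)
      where
        swapped : SameUnorderedPair H^A.τ σV σV (ρ H A)
        swapped _ = inj₂ (refl , refl)

    partialDual-eH : eH H^A ≡ subEdges A + subEdges Aᶜ
    partialDual-eH = trans (numOrbitsIn-unorderedPair _ swapOnA) (sym (numOrbitsIn-split (τ ∷ σE ∷ []) mem))
      where
        swapOnA : SameUnorderedPair H^A.τ H^A.σE τ σE
        swapOnA y with mem y
        ... | true  = inj₂ (refl , refl)
        ... | false = inj₁ (refl , refl)

    partialDual-fH : fH H^A ≡ subFaces Aᶜ
    partialDual-fH = cong (_+ isolated) (numOrbitsIn-unorderedPair _ sameOnA)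
      where
        sameOnA : SameUnorderedPair σV H^A.σE σV (ρ H Aᶜ)
        sameOnA y with mem y
        ... | true  = inj₁ (refl , refl)
        ... | false = inj₁ (refl , refl)

    partialDual-dH : dH H^A ≡ subSegments A + subSegments Aᶜ
    partialDual-dH = trans (sym (numOrbitsIn-split (ρ H A ∷ []) mem)) (cong₂ _+_ onA onAᶜ)
      where
        ρ-mem : ∀ y → mem (ρ H A y) ≡ mem y
        ρ-mem y with mem y in my
        ... | true  = trans (mem-σE y) my
        ... | false = trans (mem-τ y) my

        ρ≗σE : ∀ y → mem y ≡ true → ρ H A y ≡ σE y
        ρ≗σE y my rewrite my = refl

        ρ≗τ : ∀ y → not (mem y) ≡ true → ρ H A y ≡ τ y
        ρ≗τ y my with mem y
        ... | false = refl

        onA : numOrbitsIn (ρ H A ∷ []) mem ≡ subSegments A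
        onA = trans (numOrbitsIn-agree mem ρ≗σE mem-σE ρ-mem)
                    (*-cancelˡ-≡ _ _ 2 (trans (numOrbitsIn-fpfInvolution σE-inv σE-fpf mem mem-σE)
                                        (sym (numOrbitsIn-fpfInvolution τ-inv τ-fpf mem mem-τ))))

        onAᶜ : numOrbitsIn (ρ H A ∷ []) (not ∘ mem) ≡ subSegments Aᶜ
        onAᶜ = numOrbitsIn-agree (not ∘ mem) ρ≗τ (cong not ∘ mem-τ) (cong not ∘ ρ-mem)

open import Data.Nat as ℕ using (ℕ)
open import Data.Integer using (ℤ; _+_; _-_; _*_; +_)
open import Data.Integer.Properties using (pos-+)
open import Data.Integer.Tactic.RingSolver using (solve-∀)
open PartialDualCounts

euler-rearrangement : ∀ (v e e′ f f′ d d′ : ℕ) →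
  + f + + (e ℕ.+ e′) + + f′ - + (d ℕ.+ d′)
  ≡ ((+ v + + e + + f - + d) + (+ v + + e′ + + f′ - + d′)) - + 2 * + v
euler-rearrangement v e e′ f f′ d d′ rewrite pos-+ e e′ | pos-+ d d′ =
  ring (+ v) (+ e) (+ e′) (+ f) (+ f′) (+ d) (+ d′)
  where
    ring : ∀ (v e e′ f f′ d d′ : ℤ) →
      f + (e + e′) + f′ - (d + d′) ≡ ((v + e + f - d) + (v + e′ + f′ - d′)) - + 2 * v
    ring = solve-∀

theorem3p3 : (H : RibbonHypermap) (A : EdgeSet H) →
    χ (partialDual H A) ≡ (χSub H A + χSub H (complement H A)) - + 2 * + vH H
theorem3p3 H A
  rewrite partialDual-vH H A | partialDual-eH H A | partialDual-fH H A | partialDual-dH H A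
  = euler-rearrangement (vH H) (subEdges H A) (subEdges H Aᶜ) (subFaces H A) (subFaces H Aᶜ)
                        (subSegments H A) (subSegments H Aᶜ)
  where Aᶜ = complement H A
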